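{- For $n\geq1$, $$\sum_{e\in\mathbf{I}_n(\geq,\neq,\geq)}s^{\mathrm{ROW}(e)}t^{\mathrm{ASC}(e)}u^{e_n}=\sum_{e\in\mathbf{I}_n(>,-,\geq)}s^{\mathrm{ROW}(e)}t^{\mathrm{ASC}(e)}u^{e_n}.$$
   Context: $\mathbf{I}_n=\{(e_1,\ldots,e_n): 0\leq e_i<i\}$. $\mathbf{I}_n(\geq,\neq,\geq)$ is the set of $e\in\mathbf{I}_n$ with no $i<j<k$ such that $e_i\geq e_j$, $e_j\neq e_k$ and $e_i\geq e_k$. $\mathbf{I}_n(>,-,\geq)$ is the set of $e\in\mathbf{I}_n$ with no $i<j<k$ such that $e_i>e_j$ and $e_i\geq e_k$. $\mathrm{ROW}(e)=\{e_1,\ldots,e_n\}\setminus\{0\}$, $\mathrm{ASC}(e)=\{i\in[n-1]: e_i<e_{i+1}\}$, and for a finite set $S$ of positive integers, $s^S=\prod_{i\in S}s_i$ and $t^S=\prod_{i\in S}t_i$ (commuting variables). -}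

module Defs where

open import Level using (Level)
open import Data.Bool using (Bool; true; false; _∧_; _∨_; not; if_then_else_)
open import Data.Nat using (ℕ; zero; suc; _≡ᵇ_; _<ᵇ_; _≤ᵇ_)
open import Data.Fin using (Fin; toℕ)
open import Data.List using (List; []; _∷_; map; filter; concatMap; upTo; foldr; length)
open import Data.Bool.ListAction using (any)
open import Data.Vec using (Vec; []; _∷_; _∷ʳ_; lookup; allFin)
import Data.Vec as V
open import Algebra.Bundles using (CommutativeSemiring)
open import Relation.Nullary.Decidable using (T?)

-- Inversion sequences I_n, stored 0-indexed: position p (0 ≤ p < n) holds e_{p+1},
-- with 0 ≤ e_{p+1} ≤ p.  invSeqs n lists every element of I_n exactly once.
invSeqs : (n : ℕ) → List (Vec ℕ n)
invSeqs zero = [] ∷ []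
invSeqs (suc n) = concatMap (λ e → map (λ x → e ∷ʳ x) (upTo (suc n))) (invSeqs n)

idx : (n : ℕ) → List (Fin n)
idx n = V.toList (allFin n)

containsPat : {n : ℕ} → (ℕ → ℕ → ℕ → Bool) → Vec ℕ n → Bool
containsPat {n} P e =
  any (λ i → any (λ j → any (λ k →
        (toℕ i <ᵇ toℕ j) ∧ (toℕ j <ᵇ toℕ k) ∧ P (lookup e i) (lookup e j) (lookup e k))
      (idx n)) (idx n)) (idx n)

pat≥≠≥ : ℕ → ℕ → ℕ → Bool
pat≥≠≥ a b c = (b ≤ᵇ a) ∧ not (b ≡ᵇ c) ∧ (c ≤ᵇ a)

pat>-≥ : ℕ → ℕ → ℕ → Bool
pat>-≥ a b c = (b <ᵇ a) ∧ (c ≤ᵇ a)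

I≥≠≥ : (n : ℕ) → List (Vec ℕ n)
I≥≠≥ n = filter (λ e → T? (not (containsPat pat≥≠≥ e))) (invSeqs n)

I>-≥ : (n : ℕ) → List (Vec ℕ n)
I>-≥ n = filter (λ e → T? (not (containsPat pat>-≥ e))) (invSeqs n)

-- e_n (the last entry); the value for n = 0 is irrelevant (theorem assumes n ≥ 1)
lastE : {n : ℕ} → Vec ℕ n → ℕ
lastE [] = 0
lastE (x ∷ []) = x
lastE (x ∷ y ∷ xs) = lastE (y ∷ xs)

module _ {c ℓ : Level} (R : CommutativeSemiring c ℓ) where
  open CommutativeSemiring R

  prodR : List Carrier → Carrier
  prodR = foldr _*_ 1#

  sumR : List Carrier → Carrier
  sumR = foldr _+_ 0#

  powR : Carrier → ℕ → Carrier
  powR x zero = 1#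
  powR x (suc k) = x * powR x k

  -- ROW(e) = {e_1,…,e_n} \ {0} ⊆ {1,…,n-1};  s^ROW(e) = ∏_{v ∈ ROW(e)} s_v
  sROW : {n : ℕ} → (ℕ → Carrier) → Vec ℕ n → Carrier
  sROW {n} s e = prodR (map (λ v →
      if (not (v ≡ᵇ 0) ∧ any (λ i → lookup e i ≡ᵇ v) (idx n)) then s v else 1#) (upTo n))

  -- ASC(e) = {i ∈ [n-1] : e_i < e_{i+1}};  t^ASC(e) = ∏_{i ∈ ASC(e)} t_i
  -- (position p, 0-indexed, corresponds to i = p+1)
  tASC : {n : ℕ} → (ℕ → Carrier) → Vec ℕ n → Carrier
  tASC {n} t e = prodR (concatMap (λ p → concatMap (λ q →
      if ((suc (toℕ p) ≡ᵇ toℕ q) ∧ (lookup e p <ᵇ lookup e q)) then t (suc (toℕ p)) ∷ [] else [])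
      (idx n)) (idx n))

  weight : {n : ℕ} → (ℕ → Carrier) → (ℕ → Carrier) → Carrier → Vec ℕ n → Carrier
  weight s t u e = sROW s e * tASC t e * powR u (lastE e)

  genSum : {n : ℕ} → (ℕ → Carrier) → (ℕ → Carrier) → Carrier → List (Vec ℕ n) → Carrier
  genSum s t u L = sumR (map (weight s t u) L)

module Submission where

open import Defs
open import Level using (Level)
open import Data.Nat using (ℕ; _≤_)
open import Algebra.Bundles using (CommutativeSemiring)

open import Data.Bool using (Bool; true; false; T; not; _∧_; if_then_else_)
open import Data.Bool.ListAction using (any)
open import Data.Bool.Properties using (∧-zeroʳ)
open import Data.Fin using (Fin; toℕ; fromℕ<; zero; suc)
open import Data.Fin.Properties using (toℕ<n; toℕ-fromℕ<)
open import Data.List using ([]; _∷_; map; filter; concatMap; upTo; cartesianProductWith; _++_)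
open import Data.List.Membership.Propositional using (_∈_; lose)
open import Data.List.Membership.Propositional.Properties
  using (∈-cartesianProductWith⁺; ∈-cartesianProductWith⁻; ∈-upTo⁺; ∈-upTo⁻;
         ∈-filter⁺; ∈-filter⁻; ∈-map⁺; ∈-map⁻)
open import Data.List.Membership.Propositional.Properties.WithK using (unique∧set⇒bag)
open import Data.List.Properties using (map-cong; concatMap-cong; map-cong-local; map-id-local; map-∘)
open import Data.List.Relation.Binary.BagAndSetEquality using (∼bag⇒↭)
open import Data.List.Relation.Binary.Permutation.Propositional using (_↭_; ↭⇒↭ₛ′)
open import Data.List.Relation.Binary.Permutation.Propositional.Properties using (map⁺)
open import Data.List.Relation.Binary.Permutation.Setoid.Properties using (foldr-commMonoid)
import Data.List.Relation.Unary.All as All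
open import Data.List.Relation.Unary.AllPairs using ([]; _∷_)
open import Data.List.Relation.Unary.Any using (here; satisfied)
open import Data.List.Relation.Unary.Any.Properties using (any⁺; any⁻)
open import Data.List.Relation.Unary.Unique.Propositional using (Unique)
import Data.List.Relation.Unary.Unique.Propositional.Properties as Unique
open import Data.Nat using (zero; suc; _<_; _⊔_; _⊓_; _<ᵇ_; _≡ᵇ_; z≤n; s≤s; _≤?_; _<?_; _≟_)
open import Data.Nat.Properties
open import Data.Product using (∃; _×_; _,_; proj₂) renaming (map to map-×)
open import Data.Sum using (_⊎_; inj₁; inj₂)
open import Data.Vec using (Vec; []; _∷_; _∷ʳ_; lookup; tabulate; initLast)
open import Data.Vec.Properties using (tabulate-cong; tabulate∘lookup; ∷ʳ-injective)
open import Data.Vec.Membership.Propositional.Properties using (∈-toList⁺; ∈-allFin⁺)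
open import Function using (_∘_; _⇔_; mk⇔; Equivalence; case_of_)
open import Function.Properties.Equivalence using () renaming (sym to ⇔-sym; trans to ⇔-trans)
open import Relation.Binary.Definitions using (Tri; tri<; tri≈; tri>)
open import Relation.Binary.PropositionalEquality
  using (_≡_; _≢_; refl; sym; trans; cong; cong₂; subst; subst₂; module ≡-Reasoning)
import Relation.Binary.Reasoning.Setoid as SetoidReasoning
open import Relation.Nullary using (¬_; Dec; yes; no; does; contradiction)
open import Relation.Nullary.Decidable using (_×-dec_; ¬?; T?; dec-true; dec-false; does-⇔; decidable-stable)
open import Relation.Nullary.Reflects using (ofʸ; ofⁿ)

open Equivalence

-- Write M_p for the maximum of the entries before position p (0 if there are none).
-- In an inversion sequence avoiding (≥,≠,≥), an entry e_p ≤ M_p can only be followed by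
-- copies of itself and by entries above M_p.  The map φ raises every such entry that occurs
-- again later to M_p; afterwards an entry below its prefix maximum is followed only by entries
-- above it, which is exactly avoidance of (>,-,≥).  Its inverse ψ lowers an entry equal to its
-- prefix maximum to the minimum of the later entries (capped at M_p).  Since φ keeps the prefix
-- maxima, the last occurrence of every value, the ascent set and the last entry, it preserves
-- the weight s^ROW t^ASC u^(e_n), and the two sums are permutations of each other.

AgreeBelow : ℕ → (ℕ → ℕ) → (ℕ → ℕ) → Set
AgreeBelow n f g = ∀ {i} → i < n → f i ≡ g i

HasValue : (ℕ → ℕ) → ℕ → ℕ → Set
HasValue f n v = ∃ λ i → i < n × f i ≡ v

HasValue-cong : ∀ {f g n v} → AgreeBelow n f g → HasValue f n v ⇔ HasValue g n v
HasValue-cong f≗g = mk⇔ (λ (i , i<n , fi≡v) → i , i<n , trans (sym (f≗g i<n)) fi≡v)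
                        (λ (i , i<n , gi≡v) → i , i<n , trans (f≗g i<n) gi≡v)

lastSatisfying : ∀ {P : ℕ → Set} → (∀ q → Dec (P q)) → ∀ n → ∃ (λ q → q < n × P q) →
                 ∃ λ q → q < n × P q × (∀ {r} → q < r → r < n → ¬ P r)
lastSatisfying {P} P? (suc m) (q , q<1+m , Pq) with P? m
... | yes Pm = m , ≤-refl , Pm , λ m<r r<1+m → contradiction (≤-pred r<1+m) (<⇒≱ m<r)
... | no ¬Pm with m≤n⇒m<n∨m≡n (≤-pred q<1+m)
...   | inj₂ refl = contradiction Pq ¬Pm
...   | inj₁ q<m with lastSatisfying P? m (q , q<m , Pq)
...     | q′ , q′<m , Pq′ , last = q′ , m<n⇒m<1+n q′<m , Pq′ , later
  where
  later : ∀ {r} → q′ < r → r < suc m → ¬ P r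
  later q′<r r<1+m with m≤n⇒m<n∨m≡n (≤-pred r<1+m)
  ... | inj₁ r<m  = last q′<r r<m
  ... | inj₂ refl = ¬Pm

-- Prefix maxima and minima of later entries

prefixMax : (ℕ → ℕ) → ℕ → ℕ
prefixMax f zero    = 0
prefixMax f (suc p) = prefixMax f p ⊔ f p

prefixMax-ub : ∀ f {i p} → i < p → f i ≤ prefixMax f p
prefixMax-ub f {p = suc p} (s≤s i≤p) with m≤n⇒m<n∨m≡n i≤p
... | inj₁ i<p = ≤-trans (prefixMax-ub f i<p) (m≤m⊔n _ _)
... | inj₂ refl = m≤n⊔m _ _

prefixMax-lub : ∀ f {p b} → (∀ {i} → i < p → f i ≤ b) → prefixMax f p ≤ b
prefixMax-lub f {zero}  _  = z≤n
prefixMax-lub f {suc p} ub = ⊔-lub (prefixMax-lub f (ub ∘ m<n⇒m<1+n)) (ub ≤-refl)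

prefixMax-mono : ∀ f {p q} → p ≤ q → prefixMax f p ≤ prefixMax f q
prefixMax-mono f p≤q = prefixMax-lub f (λ i<p → prefixMax-ub f (<-≤-trans i<p p≤q))

prefixMax-attained : ∀ f p → ∃ λ i → i < suc p × f i ≡ prefixMax f (suc p)
prefixMax-attained f zero = 0 , ≤-refl , refl
prefixMax-attained f (suc p) with ⊔-sel (prefixMax f (suc p)) (f (suc p))
... | inj₂ M⊔f≡f = suc p , ≤-refl , sym M⊔f≡f
... | inj₁ M⊔f≡M with prefixMax-attained f p
...   | i , i<1+p , fi≡M = i , m<n⇒m<1+n i<1+p , trans fi≡M (sym M⊔f≡M)

prefixMax-cong : ∀ {f g} p → AgreeBelow p f g → prefixMax f p ≡ prefixMax g p
prefixMax-cong zero    _   = refl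
prefixMax-cong (suc p) f≗g = cong₂ _⊔_ (prefixMax-cong p (f≗g ∘ m<n⇒m<1+n)) (f≗g ≤-refl)

laterMin : (ℕ → ℕ) → ℕ → ℕ → ℕ → ℕ
laterMin f p zero    d = d
laterMin f p (suc m) d = if p <ᵇ m then f m ⊓ laterMin f p m d else laterMin f p m d

laterMin-≤-cap : ∀ f p n d → laterMin f p n d ≤ d
laterMin-≤-cap f p zero    d = ≤-refl
laterMin-≤-cap f p (suc m) d with p <ᵇ m
... | true  = ≤-trans (m⊓n≤n _ _) (laterMin-≤-cap f p m d)
... | false = laterMin-≤-cap f p m d

laterMin-≤ : ∀ f {p n d q} → p < q → q < n → laterMin f p n d ≤ f q
laterMin-≤ f {p} {suc m} {d} {q} p<q q<1+m with p <ᵇ m | <ᵇ-reflects-< p m | m≤n⇒m<n∨m≡n (≤-pred q<1+m)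
... | true  | _       | inj₁ q<m  = ≤-trans (m⊓n≤n _ _) (laterMin-≤ f p<q q<m)
... | true  | _       | inj₂ refl = m⊓n≤m _ _
... | false | _       | inj₁ q<m  = laterMin-≤ f p<q q<m
... | false | ofⁿ p≮m | inj₂ refl = contradiction p<q p≮m

laterMin-glb : ∀ f {p n d b} → b ≤ d → (∀ {q} → p < q → q < n → b ≤ f q) → b ≤ laterMin f p n d
laterMin-glb f {p} {zero}  b≤d _  = b≤d
laterMin-glb f {p} {suc m} b≤d lb with p <ᵇ m | <ᵇ-reflects-< p m
... | true  | ofʸ p<m = ⊓-glb (lb p<m ≤-refl) (laterMin-glb f b≤d (λ p<q → lb p<q ∘ m<n⇒m<1+n))
... | false | _       = laterMin-glb f b≤d (λ p<q → lb p<q ∘ m<n⇒m<1+n)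

laterMin-attained : ∀ f p n d → laterMin f p n d < d →
                    ∃ λ q → p < q × q < n × laterMin f p n d ≡ f q
laterMin-attained f p zero    d d<d = contradiction refl (<⇒≢ d<d)
laterMin-attained f p (suc m) d r<d with p <ᵇ m | <ᵇ-reflects-< p m
... | false | _ with laterMin-attained f p m d r<d
...   | q , p<q , q<m , r≡fq = q , p<q , m<n⇒m<1+n q<m , r≡fq
laterMin-attained f p (suc m) d r<d | true | ofʸ p<m with ⊓-sel (f m) (laterMin f p m d)
...   | inj₁ min≡fm = m , p<m , ≤-refl , min≡fm
...   | inj₂ min≡r with laterMin-attained f p m d (subst (_< d) min≡r r<d)
...     | q , p<q , q<m , r≡fq = q , p<q , m<n⇒m<1+n q<m , trans min≡r r≡fq

laterMin-suffix : ∀ f {j k q n d d′} → j < k → k < q → q < n →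
                  laterMin f j n d ≡ f q → laterMin f j n d ≤ d′ → laterMin f k n d′ ≡ laterMin f j n d
laterMin-suffix f {n = n} {d} {d′} j<k k<q q<n r≡fq r≤d′ =
  ≤-antisym (subst (_ ≤_) (sym r≡fq) (laterMin-≤ f {d = d′} k<q q<n))
            (laterMin-glb f {n = n} r≤d′ (λ k<x x<n → laterMin-≤ f {d = d} (<-trans j<k k<x) x<n))

laterMin-cong : ∀ {f g} p n d → AgreeBelow n f g → laterMin f p n d ≡ laterMin g p n d
laterMin-cong p zero    d _   = refl
laterMin-cong p (suc m) d f≗g with p <ᵇ m
... | true  = cong₂ _⊓_ (f≗g ≤-refl) (laterMin-cong p m d (f≗g ∘ m<n⇒m<1+n))
... | false = laterMin-cong p m d (f≗g ∘ m<n⇒m<1+n)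

Pattern : Set₁
Pattern = ℕ → ℕ → ℕ → Set

Pat≥≠≥ Pat>-≥ : Pattern
Pat≥≠≥ a b c = b ≤ a × b ≢ c × c ≤ a
Pat>-≥ a b c = b < a × c ≤ a

Pat≥≠≥? : ∀ a b c → Dec (Pat≥≠≥ a b c)
Pat≥≠≥? a b c = (b ≤? a) ×-dec ¬? (b ≟ c) ×-dec (c ≤? a)

Pat>-≥? : ∀ a b c → Dec (Pat>-≥ a b c)
Pat>-≥? a b c = (b <? a) ×-dec (c ≤? a)

Avoids : Pattern → (ℕ → ℕ) → ℕ → Set
Avoids P f n = ∀ {i j k} → i < j → j < k → k < n → ¬ P (f i) (f j) (f k)

Avoids-cong : ∀ {P f g n} → AgreeBelow n f g → Avoids P f n → Avoids P g n
Avoids-cong f≗g av i<j j<k k<n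
  rewrite sym (f≗g (<-trans i<j (<-trans j<k k<n))) | sym (f≗g (<-trans j<k k<n)) | sym (f≗g k<n) =
  av i<j j<k k<n

avoids≥≠≥-below-prefixMax : ∀ {f n} → Avoids Pat≥≠≥ f n → ∀ {p k} → p < k → k < n →
                            f p ≤ prefixMax f p → f k ≤ prefixMax f p → f p ≡ f k
avoids≥≠≥-below-prefixMax av {zero} _ _ fp≤0 fk≤0 = trans (n≤0⇒n≡0 fp≤0) (sym (n≤0⇒n≡0 fk≤0))
avoids≥≠≥-below-prefixMax {f} av {suc p} {k} p<k k<n fp≤M fk≤M with prefixMax-attained f p
... | i , i<p , fi≡M = decidable-stable (f (suc p) ≟ f k)
        (λ fp≢fk → av i<p p<k k<n (subst (f (suc p) ≤_) (sym fi≡M) fp≤M , fp≢fk ,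
                                   subst (f k ≤_) (sym fi≡M) fk≤M))

avoids≥≠≥-later : ∀ {f n} → Avoids Pat≥≠≥ f n → ∀ {p k} → p < k → k < n →
                  f p ≤ prefixMax f p → f k ≡ f p ⊎ prefixMax f p < f k
avoids≥≠≥-later {f} av {p} {k} p<k k<n fp≤M with f k ≤? prefixMax f p
... | yes fk≤M = inj₁ (sym (avoids≥≠≥-below-prefixMax av p<k k<n fp≤M fk≤M))
... | no fk≰M  = inj₂ (≰⇒> fk≰M)

avoids>-≥-after-dip : ∀ {g n} → Avoids Pat>-≥ g n → ∀ {q k} → q < k → k < n →
                      g q < prefixMax g q → prefixMax g q < g k
avoids>-≥-after-dip {g} av {suc q} {k} q<k k<n gq<M with prefixMax-attained g q
... | i , i<q , gi≡M = ≰⇒> λ gk≤M →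
        av i<q q<k k<n (subst (g (suc q) <_) (sym gi≡M) gq<M , subst (g k ≤_) (sym gi≡M) gk≤M)

-- The bijection φ and its inverse ψ

RepeatsAfter : (ℕ → ℕ) → ℕ → ℕ → Set
RepeatsAfter f n p = ∃ λ q → q < n × p < q × f q ≡ f p

repeatsAfter? : ∀ f n p → Dec (RepeatsAfter f n p)
repeatsAfter? f n p = anyUpTo? (λ q → (p <? q) ×-dec (f q ≟ f p)) n

φ : (ℕ → ℕ) → ℕ → ℕ → ℕ
φ f n p = if does (f p ≤? prefixMax f p) ∧ does (repeatsAfter? f n p) then prefixMax f p else f p

ψ : (ℕ → ℕ) → ℕ → ℕ → ℕ
ψ g n p = if does (g p ≟ prefixMax g p) then laterMin g p n (prefixMax g p) else g p

module _ (f : ℕ → ℕ) (n : ℕ) {p : ℕ} where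

  φ-raise : f p ≤ prefixMax f p → RepeatsAfter f n p → φ f n p ≡ prefixMax f p
  φ-raise fp≤M rep rewrite dec-true (f p ≤? prefixMax f p) fp≤M | dec-true (repeatsAfter? f n p) rep = refl

  φ-keep-large : ¬ f p ≤ prefixMax f p → φ f n p ≡ f p
  φ-keep-large fp≰M rewrite dec-false (f p ≤? prefixMax f p) fp≰M = refl

  φ-keep-last : ¬ RepeatsAfter f n p → φ f n p ≡ f p
  φ-keep-last ¬rep rewrite dec-false (repeatsAfter? f n p) ¬rep | ∧-zeroʳ (does (f p ≤? prefixMax f p)) = refl

  φ-cases : φ f n p ≡ f p ⊎ (φ f n p ≡ prefixMax f p × f p ≤ prefixMax f p × RepeatsAfter f n p)
  φ-cases = cases (f p ≤? prefixMax f p) (repeatsAfter? f n p)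
    where
    cases : Dec (f p ≤ prefixMax f p) → Dec (RepeatsAfter f n p) →
            φ f n p ≡ f p ⊎ (φ f n p ≡ prefixMax f p × f p ≤ prefixMax f p × RepeatsAfter f n p)
    cases (yes fp≤M) (yes rep) = inj₂ (φ-raise fp≤M rep , fp≤M , rep)
    cases (yes _)    (no ¬rep) = inj₁ (φ-keep-last ¬rep)
    cases (no fp≰M)  _         = inj₁ (φ-keep-large fp≰M)

module _ (g : ℕ → ℕ) (n : ℕ) {p : ℕ} where

  ψ-tie : g p ≡ prefixMax g p → ψ g n p ≡ laterMin g p n (prefixMax g p)
  ψ-tie gp≡M rewrite dec-true (g p ≟ prefixMax g p) gp≡M = refl

  ψ-keep : g p ≢ prefixMax g p → ψ g n p ≡ g p
  ψ-keep gp≢M rewrite dec-false (g p ≟ prefixMax g p) gp≢M = refl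

φ-≥ : ∀ f n p → f p ≤ φ f n p
φ-≥ f n p with φ-cases f n {p}
... | inj₁ φ≡f              = ≤-reflexive (sym φ≡f)
... | inj₂ (φ≡M , fp≤M , _) = subst (f p ≤_) (sym φ≡M) fp≤M

φ-≤-prefixMax : ∀ f n p → f p ≤ prefixMax f p → φ f n p ≤ prefixMax f p
φ-≤-prefixMax f n p fp≤M with φ-cases f n {p}
... | inj₁ φ≡f           = subst (_≤ _) (sym φ≡f) fp≤M
... | inj₂ (φ≡M , _ , _) = ≤-reflexive φ≡M

φ-≤-prefixMax-suc : ∀ f n p → φ f n p ≤ prefixMax f (suc p)
φ-≤-prefixMax-suc f n p with φ-cases f n {p}
... | inj₁ φ≡f           = subst (_≤ _) (sym φ≡f) (m≤n⊔m _ _)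
... | inj₂ (φ≡M , _ , _) = subst (_≤ _) (sym φ≡M) (m≤m⊔n _ _)

ψ-≤-prefixMax-suc : ∀ g n p → ψ g n p ≤ prefixMax g (suc p)
ψ-≤-prefixMax-suc g n p with g p ≟ prefixMax g p
... | no gp≢M  = subst (_≤ _) (sym (ψ-keep g n gp≢M)) (m≤n⊔m _ _)
... | yes gp≡M = subst (_≤ _) (sym (ψ-tie g n gp≡M)) (≤-trans (laterMin-≤-cap g p n _) (m≤m⊔n _ _))

⊔-absorb : ∀ {m x y} → x ≤ m → y ≤ m → m ⊔ x ≡ m ⊔ y
⊔-absorb x≤m y≤m = trans (m≥n⇒m⊔n≡m x≤m) (sym (m≥n⇒m⊔n≡m y≤m))

prefixMax-φ : ∀ f n p → prefixMax (φ f n) p ≡ prefixMax f p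
prefixMax-φ f n zero    = refl
prefixMax-φ f n (suc p) rewrite prefixMax-φ f n p with φ-cases f n {p}
... | inj₁ φ≡f              = cong (prefixMax f p ⊔_) φ≡f
... | inj₂ (φ≡M , fp≤M , _) = ⊔-absorb (≤-reflexive φ≡M) fp≤M

prefixMax-ψ : ∀ g n p → prefixMax (ψ g n) p ≡ prefixMax g p
prefixMax-ψ g n zero    = refl
prefixMax-ψ g n (suc p) rewrite prefixMax-ψ g n p with g p ≟ prefixMax g p
... | no gp≢M  = cong (prefixMax g p ⊔_) (ψ-keep g n gp≢M)
... | yes gp≡M = trans (cong (prefixMax g p ⊔_) (ψ-tie g n gp≡M))
                       (⊔-absorb (laterMin-≤-cap g p n _) (≤-reflexive gp≡M))

ψ-≥-after : ∀ g n {p b} → (∀ {q} → p < q → q < n → b ≤ g q) →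
            ∀ {x} → p < x → x < n → b ≤ ψ g n x
ψ-≥-after g n lb {x} p<x x<n with g x ≟ prefixMax g x
... | no gx≢M  = subst (_ ≤_) (sym (ψ-keep g n gx≢M)) (lb p<x x<n)
... | yes gx≡M = subst (_ ≤_) (sym (ψ-tie g n gx≡M))
                   (laterMin-glb g (subst (_ ≤_) gx≡M (lb p<x x<n)) (λ x<q → lb (<-trans p<x x<q)))

ψ-after-dip : ∀ {g n} → Avoids Pat>-≥ g n → ∀ {q x} → g q < prefixMax g q → q < x → x < n →
              prefixMax g q < ψ g n x
ψ-after-dip {g} {n} av gq<M = ψ-≥-after g n (λ q<k k<n → avoids>-≥-after-dip av q<k k<n gq<M)

ψ-≤-prefixMax⇒≤ : ∀ g n {p} → ψ g n p ≤ prefixMax g p → g p ≤ prefixMax g p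
ψ-≤-prefixMax⇒≤ g n {p} ψ≤M with g p ≟ prefixMax g p
... | yes gp≡M = ≤-reflexive gp≡M
... | no gp≢M  = subst (_≤ _) (ψ-keep g n gp≢M) ψ≤M

φ-last : ∀ f m → φ f (suc m) m ≡ f m
φ-last f m = φ-keep-last f (suc m) λ (_ , q<1+m , m<q , _) → contradiction (≤-pred q<1+m) (<⇒≱ m<q)

φ-after-dip : ∀ {f n} → Avoids Pat≥≠≥ f n → ∀ {j k} → j < k → k < n →
              φ f n j < prefixMax f j → prefixMax f j < φ f n k
φ-after-dip {f} {n} av {j} {k} j<k k<n φj<M with φ-cases f n {j}
... | inj₂ (φj≡M , _) = contradiction φj≡M (<⇒≢ φj<M)
... | inj₁ φj≡fj = case avoids≥≠≥-later av j<k k<n fj≤M of λ where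
    (inj₁ fk≡fj) → contradiction (φ-raise f n fj≤M (k , k<n , j<k , fk≡fj)) (<⇒≢ φj<M)
    (inj₂ M<fk)  → <-≤-trans M<fk (φ-≥ f n k)
  where fj≤M = <⇒≤ (subst (_< _) φj≡fj φj<M)

φ-avoids>-≥ : ∀ f n → Avoids Pat≥≠≥ f n → Avoids Pat>-≥ (φ f n) n
φ-avoids>-≥ f n av {i} i<j j<k k<n (φj<φi , φk≤φi) =
  <⇒≱ (φ-after-dip av j<k k<n (<-≤-trans φj<φi φi≤M)) (≤-trans φk≤φi φi≤M)
  where φi≤M = ≤-trans (φ-≤-prefixMax-suc f n i) (prefixMax-mono f i<j)

-- The later minimum r < M_j sits at a dip q, after which every entry exceeds M_q ≥ M_j;
-- an entry k strictly between j and q with ψ k ≤ M_j must be a tie, and its own later minimum is again r.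
ψ-meets-laterMin : ∀ {g n} → Avoids Pat>-≥ g n → ∀ {j k q} → j < k → k < n → j < q → q < n →
                   laterMin g j n (prefixMax g j) ≡ g q → g q < prefixMax g j →
                   ψ g n k ≤ prefixMax g j → ψ g n k ≡ g q
ψ-meets-laterMin {g} {n} av {j} {k} {q} j<k k<n j<q q<n r≡gq gq<Mj ψk≤Mj = byPosition (<-cmp k q)
  where
  Mj≤Mk = prefixMax-mono g (<⇒≤ j<k)
  gq<Mq = <-≤-trans gq<Mj (prefixMax-mono g (<⇒≤ j<q))

  byPosition : Tri (k < q) (k ≡ q) (q < k) → ψ g n k ≡ g q
  byPosition (tri> _ _ q<k) =
    contradiction (≤-trans ψk≤Mj (prefixMax-mono g (<⇒≤ j<q))) (<⇒≱ (ψ-after-dip av gq<Mq q<k k<n))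
  byPosition (tri≈ _ k≡q _) = subst (λ x → ψ g n x ≡ g q) (sym k≡q) (ψ-keep g n (<⇒≢ gq<Mq))
  byPosition (tri< k<q _ _) with m≤n⇒m<n∨m≡n (ψ-≤-prefixMax⇒≤ g n (≤-trans ψk≤Mj Mj≤Mk))
  ... | inj₁ gk<Mk = contradiction (avoids>-≥-after-dip av k<q q<n gk<Mk) (≤⇒≯ (≤-trans (<⇒≤ gq<Mj) Mj≤Mk))
  ... | inj₂ gk≡Mk = begin
    ψ g n k                           ≡⟨ ψ-tie g n gk≡Mk ⟩
    laterMin g k n (prefixMax g k)    ≡⟨ laterMin-suffix g j<k k<q q<n r≡gq (≤-trans (<⇒≤ r<Mj) Mj≤Mk) ⟩
    laterMin g j n (prefixMax g j)    ≡⟨ r≡gq ⟩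
    g q                               ∎
    where
    open ≡-Reasoning
    r<Mj = subst (_< _) (sym r≡gq) gq<Mj

ψ-constant-below-prefixMax : ∀ {g n} → Avoids Pat>-≥ g n → ∀ {j k} → j < k → k < n →
                             ψ g n j ≤ prefixMax g j → ψ g n k ≤ prefixMax g j → ψ g n j ≡ ψ g n k
ψ-constant-below-prefixMax {g} {n} av {j} {k} j<k k<n ψj≤M ψk≤M
  with m≤n⇒m<n∨m≡n (ψ-≤-prefixMax⇒≤ g n ψj≤M)
... | inj₁ gj<M = contradiction ψk≤M (<⇒≱ (ψ-after-dip av gj<M j<k k<n))
... | inj₂ gj≡M with laterMin g j n (prefixMax g j) <? prefixMax g j
...   | no r≮M = trans (ψ-tie g n gj≡M) (≤-antisym (≤-trans (laterMin-≤-cap g j n _) M≤ψk) r≥ψk)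
  where
  r≡M = ≤-antisym (laterMin-≤-cap g j n _) (≮⇒≥ r≮M)
  M≤ψk = ψ-≥-after g n (λ j<q q<n → subst (_≤ _) r≡M (laterMin-≤ g j<q q<n)) j<k k<n
  r≥ψk = subst (ψ g n k ≤_) (sym r≡M) ψk≤M
...   | yes r<M with laterMin-attained g j n _ r<M
...     | q , j<q , q<n , r≡gq = trans (trans (ψ-tie g n gj≡M) r≡gq)
            (sym (ψ-meets-laterMin av j<k k<n j<q q<n r≡gq (subst (_< _) r≡gq r<M) ψk≤M))

ψ-avoids≥≠≥ : ∀ g n → Avoids Pat>-≥ g n → Avoids Pat≥≠≥ (ψ g n) n
ψ-avoids≥≠≥ g n av {i} i<j j<k k<n (ψj≤ψi , ψj≢ψk , ψk≤ψi) =
  ψj≢ψk (ψ-constant-below-prefixMax av j<k k<n (≤-trans ψj≤ψi ψi≤M) (≤-trans ψk≤ψi ψi≤M))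
  where ψi≤M = ≤-trans (ψ-≤-prefixMax-suc g n i) (prefixMax-mono g i<j)

φ-keeps-last-occurrence : ∀ f n {a q v} → a ≤ q → q < n → f q ≡ v →
                          ∃ λ q′ → a ≤ q′ × q′ < n × φ f n q′ ≡ v
φ-keeps-last-occurrence f n {a} {q} {v} a≤q q<n fq≡v
  with lastSatisfying (λ r → (a ≤? r) ×-dec (f r ≟ v)) n (q , q<n , a≤q , fq≡v)
... | q′ , q′<n , (a≤q′ , fq′≡v) , last = q′ , a≤q′ , q′<n , trans (φ-keep-last f n noRepeat) fq′≡v
  where
  noRepeat : ¬ RepeatsAfter f n q′
  noRepeat (r , r<n , q′<r , fr≡fq′) =
    last q′<r r<n (≤-trans a≤q′ (<⇒≤ q′<r) , trans fr≡fq′ fq′≡v)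

laterMin-φ-≥ : ∀ {f n} → Avoids Pat≥≠≥ f n → ∀ {p} → f p ≤ prefixMax f p →
               f p ≤ laterMin (φ f n) p n (prefixMax f p)
laterMin-φ-≥ {f} {n} av {p} fp≤M = laterMin-glb (φ f n) fp≤M later
  where
  later : ∀ {x} → p < x → x < n → f p ≤ φ f n x
  later {x} p<x x<n with avoids≥≠≥-later av p<x x<n fp≤M
  ... | inj₁ fx≡fp = ≤-trans (≤-reflexive (sym fx≡fp)) (φ-≥ f n x)
  ... | inj₂ M<fx  = ≤-trans (≤-trans fp≤M (<⇒≤ M<fx)) (φ-≥ f n x)

ψ-φ-tie : ∀ f n {p} → φ f n p ≡ prefixMax f p → ψ (φ f n) n p ≡ laterMin (φ f n) p n (prefixMax f p)
ψ-φ-tie f n {p} φ≡M = trans (ψ-tie (φ f n) n (trans φ≡M (sym (prefixMax-φ f n p))))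
                            (cong (laterMin (φ f n) p n) (prefixMax-φ f n p))

ψ∘φ : ∀ {f n} → Avoids Pat≥≠≥ f n → ∀ {p} → ψ (φ f n) n p ≡ f p
ψ∘φ {f} {n} av {p} with φ-cases f n {p}
... | inj₂ (φ≡M , fp≤M , (q , q<n , p<q , fq≡fp)) =
  trans (ψ-φ-tie f n φ≡M) (≤-antisym r≤fp (laterMin-φ-≥ av fp≤M))
  where
  r≤fp : laterMin (φ f n) p n (prefixMax f p) ≤ f p
  r≤fp with φ-keeps-last-occurrence f n p<q q<n fq≡fp
  ... | q′ , p<q′ , q′<n , φq′≡fp =
    subst (_ ≤_) φq′≡fp (laterMin-≤ (φ f n) {d = prefixMax f p} p<q′ q′<n)
... | inj₁ φ≡f with f p ≟ prefixMax f p
...   | no fp≢M  = trans (ψ-keep (φ f n) n (subst₂ _≢_ (sym φ≡f) (sym (prefixMax-φ f n p)) fp≢M)) φ≡f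
...   | yes fp≡M =
  trans (ψ-φ-tie f n (trans φ≡f fp≡M)) (≤-antisym r≤fp (laterMin-φ-≥ av (≤-reflexive fp≡M)))
  where
  r≤fp : laterMin (φ f n) p n (prefixMax f p) ≤ f p
  r≤fp = subst (laterMin (φ f n) p n (prefixMax f p) ≤_) (sym fp≡M) (laterMin-≤-cap (φ f n) p n _)

φ-at-prefixMax : ∀ f n {p} → f p ≡ prefixMax f p → φ f n p ≡ f p
φ-at-prefixMax f n {p} fp≡M with φ-cases f n {p}
... | inj₁ φ≡f           = φ≡f
... | inj₂ (φ≡M , _ , _) = trans φ≡M (sym fp≡M)

φ∘ψ : ∀ {g n} → Avoids Pat>-≥ g n → ∀ {p} → φ (ψ g n) n p ≡ g p
φ∘ψ {g} {n} av {p} with <-cmp (g p) (prefixMax g p)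
... | tri> _ gp≢M M<gp = trans (φ-keep-large (ψ g n) n ψp≰M) ψp≡gp
  where
  ψp≡gp = ψ-keep g n gp≢M
  ψp≰M : ¬ ψ g n p ≤ prefixMax (ψ g n) p
  ψp≰M ψp≤M = <⇒≱ M<gp (subst₂ _≤_ ψp≡gp (prefixMax-ψ g n p) ψp≤M)
... | tri< gp<M gp≢M _ = trans (φ-keep-last (ψ g n) n noRepeat) (ψ-keep g n gp≢M)
  where
  noRepeat : ¬ RepeatsAfter (ψ g n) n p
  noRepeat (q , q<n , p<q , ψq≡ψp) =
    <⇒≢ (<-trans gp<M (ψ-after-dip av gp<M p<q q<n)) (sym (trans ψq≡ψp (ψ-keep g n gp≢M)))
... | tri≈ _ gp≡M _ with laterMin g p n (prefixMax g p) <? prefixMax g p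
...   | no r≮M = begin
  φ (ψ g n) n p                    ≡⟨ φ-at-prefixMax (ψ g n) n (trans ψp≡M (sym (prefixMax-ψ g n p))) ⟩
  ψ g n p                          ≡⟨ ψp≡M ⟩
  prefixMax g p                    ≡⟨ sym gp≡M ⟩
  g p                              ∎
  where
  open ≡-Reasoning
  ψp≡M = trans (ψ-tie g n gp≡M) (≤-antisym (laterMin-≤-cap g p n _) (≮⇒≥ r≮M))
...   | yes r<M with laterMin-attained g p n _ r<M
...     | q , p<q , q<n , r≡gq = begin
  φ (ψ g n) n p                    ≡⟨ φ-raise (ψ g n) n ψp≤M (q , q<n , p<q , sym ψp≡ψq) ⟩
  prefixMax (ψ g n) p              ≡⟨ prefixMax-ψ g n p ⟩
  prefixMax g p                    ≡⟨ sym gp≡M ⟩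
  g p                              ∎
  where
  open ≡-Reasoning
  ψp≡r = ψ-tie g n gp≡M
  gq<Mq = <-≤-trans (subst (_< _) r≡gq r<M) (prefixMax-mono g (<⇒≤ p<q))
  ψp≡ψq = trans ψp≡r (trans r≡gq (sym (ψ-keep g n (<⇒≢ gq<Mq))))
  ψp≤M = subst₂ _≤_ (sym ψp≡r) (sym (prefixMax-ψ g n p)) (<⇒≤ r<M)

before-nonrecord : ∀ {f n} → Avoids Pat≥≠≥ f n → ∀ {p} → suc p < n → f (suc p) ≤ prefixMax f (suc p) →
                   f (suc p) ≤ f p × φ f n p ≡ prefixMax f (suc p)
before-nonrecord {f} {n} av {p} 1+p<n f1≤M1 with f p ≤? prefixMax f p
... | no fp≰M = subst (f (suc p) ≤_) M1≡fp f1≤M1 , trans (φ-keep-large f n fp≰M) (sym M1≡fp)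
  where M1≡fp = m≤n⇒m⊔n≡n (<⇒≤ (≰⇒> fp≰M))
... | yes fp≤M with avoids≥≠≥-later av ≤-refl 1+p<n fp≤M
...   | inj₂ M<f1  = contradiction (subst (f (suc p) ≤_) (m≥n⇒m⊔n≡m fp≤M) f1≤M1) (<⇒≱ M<f1)
...   | inj₁ f1≡fp = ≤-reflexive f1≡fp ,
                     trans (φ-raise f n fp≤M (suc p , 1+p<n , ≤-refl , f1≡fp)) (sym (m≥n⇒m⊔n≡m fp≤M))

φ-ascent⇔ : ∀ {f n} → Avoids Pat≥≠≥ f n → ∀ {p} → suc p < n →
            (φ f n p < φ f n (suc p)) ⇔ (f p < f (suc p))
φ-ascent⇔ {f} {n} av {p} 1+p<n with f (suc p) ≤? prefixMax f (suc p)
... | no f1≰M1 = mk⇔ (λ _ → ≤-<-trans (m≤n⊔m _ _) M1<f1)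
                     (λ _ → <-≤-trans (≤-<-trans (φ-≤-prefixMax-suc f n p) M1<f1) (φ-≥ f n (suc p)))
  where M1<f1 = ≰⇒> f1≰M1
... | yes f1≤M1 with before-nonrecord av 1+p<n f1≤M1
...   | f1≤fp , φp≡M1 =
  mk⇔ (λ φ< → contradiction φ< (≤⇒≯ φ1≤φp)) (λ f< → contradiction f< (≤⇒≯ f1≤fp))
  where φ1≤φp = subst (φ f n (suc p) ≤_) (sym φp≡M1) (φ-≤-prefixMax f n (suc p) f1≤M1)

φ-hasValue⇔ : ∀ f n v → HasValue (φ f n) n v ⇔ HasValue f n v
φ-hasValue⇔ f n v = mk⇔ unraise keepLast
  where
  unraise : HasValue (φ f n) n v → HasValue f n v
  unraise (i , i<n , φi≡v) with φ-cases f n {i}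
  ... | inj₁ φi≡fi = i , i<n , trans (sym φi≡fi) φi≡v
  ... | inj₂ (φi≡M , fi≤M , _) with prefixMax-attained f i
  ...   | j , j<1+i , fj≡M1 =
    j , <-≤-trans j<1+i i<n , trans fj≡M1 (trans (m≥n⇒m⊔n≡m fi≤M) (trans (sym φi≡M) φi≡v))
  keepLast : HasValue f n v → HasValue (φ f n) n v
  keepLast (i , i<n , fi≡v) with φ-keeps-last-occurrence f n z≤n i<n fi≡v
  ... | q , _ , q<n , φq≡v = q , q<n , φq≡v

IsInversion : (ℕ → ℕ) → ℕ → Set
IsInversion f n = ∀ {p} → p < n → f p ≤ p

prefixMax-suc-≤ : ∀ {f n} → IsInversion f n → ∀ {p} → p < n → prefixMax f (suc p) ≤ p
prefixMax-suc-≤ {f} inv p<n = prefixMax-lub f (λ i<1+p → ≤-trans (inv (<-≤-trans i<1+p p<n)) (≤-pred i<1+p))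

φ-isInversion : ∀ {f n} → IsInversion f n → IsInversion (φ f n) n
φ-isInversion {f} {n} inv {p} p<n = ≤-trans (φ-≤-prefixMax-suc f n p) (prefixMax-suc-≤ inv p<n)

ψ-isInversion : ∀ {g n} → IsInversion g n → IsInversion (ψ g n) n
ψ-isInversion {g} {n} inv {p} p<n = ≤-trans (ψ-≤-prefixMax-suc g n p) (prefixMax-suc-≤ inv p<n)

IsInversion-cong : ∀ {f g n} → AgreeBelow n f g → IsInversion f n → IsInversion g n
IsInversion-cong f≗g inv p<n = subst (_≤ _) (f≗g p<n) (inv p<n)

RepeatsAfter-resp : ∀ {f g n p} → AgreeBelow n f g → p < n → RepeatsAfter f n p → RepeatsAfter g n p
RepeatsAfter-resp f≗g p<n (q , q<n , p<q , fq≡fp) = q , q<n , p<q , trans (sym (f≗g q<n)) (trans fq≡fp (f≗g p<n))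

φ-cong : ∀ {f g n} → AgreeBelow n f g → AgreeBelow n (φ f n) (φ g n)
φ-cong {f} {g} {n} f≗g {p} p<n
  rewrite does-⇔ (mk⇔ (RepeatsAfter-resp f≗g p<n) (RepeatsAfter-resp (sym ∘ f≗g) p<n))
                 (repeatsAfter? f n p) (repeatsAfter? g n p)
        | prefixMax-cong p (λ i<p → f≗g (<-trans i<p p<n))
        | f≗g p<n = refl

ψ-cong : ∀ {f g n} → AgreeBelow n f g → AgreeBelow n (ψ f n) (ψ g n)
ψ-cong {f} {g} {n} f≗g {p} p<n
  rewrite prefixMax-cong p (λ i<p → f≗g (<-trans i<p p<n))
        | laterMin-cong {f} {g} p n (prefixMax g p) f≗g
        | f≗g p<n = refl

-- Inversion sequences as vectors

-- 0-indexed, and 0 past the end: only the values below the length carry information.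
at : ∀ {n} → Vec ℕ n → ℕ → ℕ
at []       _       = 0
at (x ∷ _)  zero    = x
at (_ ∷ xs) (suc p) = at xs p

lookup-at : ∀ {n} (e : Vec ℕ n) i → lookup e i ≡ at e (toℕ i)
lookup-at (_ ∷ _)  zero    = refl
lookup-at (_ ∷ xs) (suc i) = lookup-at xs i

lookup-fromℕ< : ∀ {n} (e : Vec ℕ n) {p} (p<n : p < n) → lookup e (fromℕ< p<n) ≡ at e p
lookup-fromℕ< e p<n = trans (lookup-at e _) (cong (at e) (toℕ-fromℕ< p<n))

fromFun : (n : ℕ) → (ℕ → ℕ) → Vec ℕ n
fromFun n h = tabulate (h ∘ toℕ)

at-fromFun : ∀ n h → AgreeBelow n (at (fromFun n h)) h
at-fromFun (suc n) h {zero}  _         = refl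
at-fromFun (suc n) h {suc p} (s≤s p<n) = at-fromFun n (h ∘ suc) p<n

fromFun-at : ∀ {n} (e : Vec ℕ n) → fromFun n (at e) ≡ e
fromFun-at e = trans (tabulate-cong (sym ∘ lookup-at e)) (tabulate∘lookup e)

fromFun-cong : ∀ {n h h′} → AgreeBelow n h h′ → fromFun n h ≡ fromFun n h′
fromFun-cong h≗h′ = tabulate-cong (h≗h′ ∘ toℕ<n)

φVec ψVec : ∀ {n} → Vec ℕ n → Vec ℕ n
φVec {n} e = fromFun n (φ (at e) n)
ψVec {n} e = fromFun n (ψ (at e) n)

ψVec∘φVec : ∀ {n} (e : Vec ℕ n) → Avoids Pat≥≠≥ (at e) n → ψVec (φVec e) ≡ e
ψVec∘φVec {n} e av =
  trans (fromFun-cong λ p<n → trans (ψ-cong (at-fromFun n (φ (at e) n)) p<n) (ψ∘φ av)) (fromFun-at e)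

φVec∘ψVec : ∀ {n} (e : Vec ℕ n) → Avoids Pat>-≥ (at e) n → φVec (ψVec e) ≡ e
φVec∘ψVec {n} e av =
  trans (fromFun-cong λ p<n → trans (φ-cong (at-fromFun n (ψ (at e) n)) p<n) (φ∘ψ av)) (fromFun-at e)

at-∷ʳ : ∀ {n} (e : Vec ℕ n) x → AgreeBelow n (at (e ∷ʳ x)) (at e)
at-∷ʳ (_ ∷ _)  x {zero}  _         = refl
at-∷ʳ (_ ∷ xs) x {suc p} (s≤s p<n) = at-∷ʳ xs x p<n

at-∷ʳ-last : ∀ {n} (e : Vec ℕ n) x → at (e ∷ʳ x) n ≡ x
at-∷ʳ-last []       x = refl
at-∷ʳ-last (_ ∷ xs) x = at-∷ʳ-last xs x

concatMap-map≡cartesianProductWith : ∀ {A B C : Set} (f : A → B → C) xs ys →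
                                     concatMap (λ x → map (f x) ys) xs ≡ cartesianProductWith f xs ys
concatMap-map≡cartesianProductWith f []       ys = refl
concatMap-map≡cartesianProductWith f (x ∷ xs) ys = cong (map (f x) ys ++_) (concatMap-map≡cartesianProductWith f xs ys)

invSeqs-suc : ∀ n → invSeqs (suc n) ≡ cartesianProductWith _∷ʳ_ (invSeqs n) (upTo (suc n))
invSeqs-suc n = concatMap-map≡cartesianProductWith _∷ʳ_ (invSeqs n) (upTo (suc n))

∈-invSeqs⁻ : ∀ n {e : Vec ℕ n} → e ∈ invSeqs n → IsInversion (at e) n
∈-invSeqs⁻ (suc n) e∈ {p} p<1+n rewrite invSeqs-suc n
  with ∈-cartesianProductWith⁻ _∷ʳ_ (invSeqs n) (upTo (suc n)) e∈
... | e′ , x , e′∈ , x∈ , refl with m≤n⇒m<n∨m≡n (≤-pred p<1+n)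
...   | inj₁ p<n  = subst (_≤ p) (sym (at-∷ʳ e′ x p<n)) (∈-invSeqs⁻ n e′∈ p<n)
...   | inj₂ refl = subst (_≤ p) (sym (at-∷ʳ-last e′ x)) (≤-pred (∈-upTo⁻ x∈))

∈-invSeqs⁺ : ∀ n {e : Vec ℕ n} → IsInversion (at e) n → e ∈ invSeqs n
∈-invSeqs⁺ zero    {[]} _   = here refl
∈-invSeqs⁺ (suc n) {e}  inv rewrite invSeqs-suc n with initLast e
... | e′ , x , refl = ∈-cartesianProductWith⁺ _∷ʳ_ (∈-invSeqs⁺ n inv′) (∈-upTo⁺ (s≤s x≤n))
  where
  inv′ : IsInversion (at e′) n
  inv′ p<n = subst (_≤ _) (at-∷ʳ e′ x p<n) (inv (m<n⇒m<1+n p<n))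
  x≤n = subst (_≤ n) (at-∷ʳ-last e′ x) (inv ≤-refl)

invSeqs-unique : ∀ n → Unique (invSeqs n)
invSeqs-unique zero    = All.[] ∷ []
invSeqs-unique (suc n) rewrite invSeqs-suc n =
  Unique.cartesianProductWith⁺ _∷ʳ_ (λ {w} {x} → ∷ʳ-injective w x) (invSeqs-unique n) (Unique.upTo⁺ (suc n))

T-not⇔¬T : ∀ {b} → T (not b) ⇔ (¬ T b)
T-not⇔¬T {true}  = mk⇔ (λ ()) (λ ¬t → ¬t _)
T-not⇔¬T {false} = mk⇔ (λ _ ()) (λ _ → _)

T-does⇔ : ∀ {A : Set} (a? : Dec A) → T (does a?) ⇔ A
T-does⇔ (yes a)  = mk⇔ (λ _ → a) (λ _ → _)
T-does⇔ (no ¬a) = mk⇔ (λ ()) ¬a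

T-any-idx⇔ : ∀ {n} (b : Fin n → Bool) → T (any b (idx n)) ⇔ ∃ λ i → T (b i)
T-any-idx⇔ {n} b =
  mk⇔ (satisfied ∘ any⁻ b (idx n)) (λ (i , bi) → any⁺ b (lose {P = T ∘ b} (∈-toList⁺ (∈-allFin⁺ i)) bi))

Contains : Pattern → (ℕ → ℕ) → ℕ → Set
Contains P f n = ∃ λ i → ∃ λ j → ∃ λ k → i < j × j < k × k < n × P (f i) (f j) (f k)

Avoids⇔¬Contains : ∀ {P f n} → Avoids P f n ⇔ (¬ Contains P f n)
Avoids⇔¬Contains = mk⇔ (λ av (_ , _ , _ , i<j , j<k , k<n , Pijk) → av i<j j<k k<n Pijk)
                       (λ ¬c {i} {j} {k} i<j j<k k<n Pijk → ¬c (i , j , k , i<j , j<k , k<n , Pijk))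

module _ {P : Pattern} (P? : ∀ a b c → Dec (P a b c)) {n : ℕ} (e : Vec ℕ n) where

  containsPat⇔ : T (containsPat (λ a b c → does (P? a b c)) e) ⇔ Contains P (at e) n
  containsPat⇔ = mk⇔ found place
    where
    occurrence? : ∀ i j k → Dec (toℕ i < toℕ j × toℕ j < toℕ k × P (lookup e i) (lookup e j) (lookup e k))
    occurrence? i j k = (toℕ i <? toℕ j) ×-dec (toℕ j <? toℕ k) ×-dec P? (lookup e i) (lookup e j) (lookup e k)
    found : T (containsPat (λ a b c → does (P? a b c)) e) → Contains P (at e) n
    found t with to (T-any-idx⇔ _) t
    ... | i , ti with to (T-any-idx⇔ _) ti
    ... | j , tj with to (T-any-idx⇔ _) tj
    ... | k , tk with to (T-does⇔ (occurrence? i j k)) tk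
    ... | i<j , j<k , Pijk rewrite lookup-at e i | lookup-at e j | lookup-at e k =
      toℕ i , toℕ j , toℕ k , i<j , j<k , toℕ<n k , Pijk
    place : Contains P (at e) n → T (containsPat (λ a b c → does (P? a b c)) e)
    place (i , j , k , i<j , j<k , k<n , Pijk) =
      from (T-any-idx⇔ _) (fi , from (T-any-idx⇔ _) (fj , from (T-any-idx⇔ _) (fk ,
        from (T-does⇔ (occurrence? fi fj fk)) (fi<fj , fj<fk , Pfijk))))
      where
      j<n = <-trans j<k k<n
      i<n = <-trans i<j j<n
      fi fj fk : Fin n
      fi = fromℕ< i<n
      fj = fromℕ< j<n
      fk = fromℕ< k<n
      fi<fj : toℕ fi < toℕ fj
      fi<fj rewrite toℕ-fromℕ< i<n | toℕ-fromℕ< j<n = i<j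
      fj<fk : toℕ fj < toℕ fk
      fj<fk rewrite toℕ-fromℕ< j<n | toℕ-fromℕ< k<n = j<k
      Pfijk : P (lookup e fi) (lookup e fj) (lookup e fk)
      Pfijk rewrite lookup-fromℕ< e i<n | lookup-fromℕ< e j<n | lookup-fromℕ< e k<n = Pijk

  avoids⇔ : Avoids P (at e) n ⇔ T (not (containsPat (λ a b c → does (P? a b c)) e))
  avoids⇔ = mk⇔ notContaining avoiding
    where
    notContaining : Avoids P (at e) n → T (not (containsPat (λ a b c → does (P? a b c)) e))
    notContaining av = from T-not⇔¬T (to (Avoids⇔¬Contains {P} {at e} {n}) av ∘ to containsPat⇔)
    avoiding : T (not (containsPat (λ a b c → does (P? a b c)) e)) → Avoids P (at e) n
    avoiding t = from (Avoids⇔¬Contains {P} {at e} {n}) (to T-not⇔¬T t ∘ from containsPat⇔)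

  ∈-avoiders⇔ : e ∈ filter (λ e → T? (not (containsPat (λ a b c → does (P? a b c)) e))) (invSeqs n) ⇔
                (IsInversion (at e) n × Avoids P (at e) n)
  ∈-avoiders⇔ = mk⇔ (λ e∈ → map-× (∈-invSeqs⁻ n) (from avoids⇔) (∈-filter⁻ _ e∈)) member
    where
    member : IsInversion (at e) n × Avoids P (at e) n →
             e ∈ filter (λ e → T? (not (containsPat (λ a b c → does (P? a b c)) e))) (invSeqs n)
    member (inv , av) = ∈-filter⁺ _ (∈-invSeqs⁺ n inv) (to avoids⇔ av)

T⇔T⇒≡ : ∀ {a b} → (T a ⇔ T b) → a ≡ b
T⇔T⇒≡ {a} {b} T⇔T = does-⇔ T⇔T (T? a) (T? b)

hasValue⇔any : ∀ {n} (e : Vec ℕ n) v → T (any (λ i → lookup e i ≡ᵇ v) (idx n)) ⇔ HasValue (at e) n v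
hasValue⇔any {n} e v = mk⇔ found place
  where
  found : T (any (λ i → lookup e i ≡ᵇ v) (idx n)) → HasValue (at e) n v
  found t with to (T-any-idx⇔ _) t
  ... | i , ei≡v = toℕ i , toℕ<n i , trans (sym (lookup-at e i)) (to (T-does⇔ (lookup e i ≟ v)) ei≡v)
  place : HasValue (at e) n v → T (any (λ i → lookup e i ≡ᵇ v) (idx n))
  place (p , p<n , ep≡v) =
    from (T-any-idx⇔ _) (fromℕ< p<n ,
      from (T-does⇔ (lookup e (fromℕ< p<n) ≟ v)) (trans (lookup-fromℕ< e p<n) ep≡v))

valueTest-φVec : ∀ {n} (e : Vec ℕ n) v →
                 any (λ i → lookup (φVec e) i ≡ᵇ v) (idx n) ≡ any (λ i → lookup e i ≡ᵇ v) (idx n)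
valueTest-φVec {n} e v = T⇔T⇒≡
  (⇔-trans (hasValue⇔any (φVec e) v)
  (⇔-trans (HasValue-cong (at-fromFun n (φ (at e) n)))
  (⇔-trans (φ-hasValue⇔ (at e) n v) (⇔-sym (hasValue⇔any e v)))))

ascentTest-φVec : ∀ {n} (e : Vec ℕ n) → Avoids Pat≥≠≥ (at e) n → ∀ p q →
                  ((suc (toℕ p) ≡ᵇ toℕ q) ∧ (lookup (φVec e) p <ᵇ lookup (φVec e) q)) ≡
                  ((suc (toℕ p) ≡ᵇ toℕ q) ∧ (lookup e p <ᵇ lookup e q))
ascentTest-φVec {n} e av p q =
  does-⇔ (mk⇔ (λ (p+1≡q , lt) → p+1≡q , to (ascent p+1≡q) lt)
              (λ (p+1≡q , lt) → p+1≡q , from (ascent p+1≡q) lt))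
         ((suc (toℕ p) ≟ toℕ q) ×-dec (lookup (φVec e) p <? lookup (φVec e) q))
         ((suc (toℕ p) ≟ toℕ q) ×-dec (lookup e p <? lookup e q))
  where
  ascent : suc (toℕ p) ≡ toℕ q → (lookup (φVec e) p < lookup (φVec e) q) ⇔ (lookup e p < lookup e q)
  ascent p+1≡q
    rewrite lookup-at (φVec e) p | lookup-at (φVec e) q | lookup-at e p | lookup-at e q
          | at-fromFun n (φ (at e) n) (toℕ<n p) | at-fromFun n (φ (at e) n) (toℕ<n q)
          | sym p+1≡q = φ-ascent⇔ av (subst (_< n) (sym p+1≡q) (toℕ<n q))

lastE-at : ∀ {m} (e : Vec ℕ (suc m)) → lastE e ≡ at e m
lastE-at (_ ∷ [])     = refl
lastE-at (_ ∷ y ∷ xs) = lastE-at (y ∷ xs)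

lastE-φVec : ∀ {n} (e : Vec ℕ n) → lastE (φVec e) ≡ lastE e
lastE-φVec {zero}  [] = refl
lastE-φVec {suc m} e  = begin
  lastE (φVec e)          ≡⟨ lastE-at (φVec e) ⟩
  at (φVec e) m           ≡⟨ at-fromFun (suc m) (φ (at e) (suc m)) ≤-refl ⟩
  φ (at e) (suc m) m      ≡⟨ φ-last (at e) m ⟩
  at e m                  ≡⟨ lastE-at e ⟨
  lastE e                 ∎
  where open ≡-Reasoning

∈-I≥≠≥⇔ : ∀ {n} {e : Vec ℕ n} → e ∈ I≥≠≥ n ⇔ (IsInversion (at e) n × Avoids Pat≥≠≥ (at e) n)
∈-I≥≠≥⇔ {e = e} = ∈-avoiders⇔ Pat≥≠≥? e

∈-I>-≥⇔ : ∀ {n} {e : Vec ℕ n} → e ∈ I>-≥ n ⇔ (IsInversion (at e) n × Avoids Pat>-≥ (at e) n)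
∈-I>-≥⇔ {e = e} = ∈-avoiders⇔ Pat>-≥? e

φVec-∈ : ∀ {n} {e : Vec ℕ n} → e ∈ I≥≠≥ n → φVec e ∈ I>-≥ n
φVec-∈ {n} {e} e∈ with to ∈-I≥≠≥⇔ e∈
... | inv , av =
  from ∈-I>-≥⇔ (IsInversion-cong agree (φ-isInversion inv) ,
                Avoids-cong {Pat>-≥} agree (φ-avoids>-≥ (at e) n av))
  where
  agree : AgreeBelow n (φ (at e) n) (at (φVec e))
  agree p<n = sym (at-fromFun n (φ (at e) n) p<n)

ψVec-∈ : ∀ {n} {e : Vec ℕ n} → e ∈ I>-≥ n → ψVec e ∈ I≥≠≥ n
ψVec-∈ {n} {e} e∈ with to ∈-I>-≥⇔ e∈
... | inv , av =
  from ∈-I≥≠≥⇔ (IsInversion-cong agree (ψ-isInversion inv) ,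
                Avoids-cong {Pat≥≠≥} agree (ψ-avoids≥≠≥ (at e) n av))
  where
  agree : AgreeBelow n (ψ (at e) n) (at (ψVec e))
  agree p<n = sym (at-fromFun n (ψ (at e) n) p<n)

map-ψVec∘φVec : ∀ n → map ψVec (map φVec (I≥≠≥ n)) ≡ I≥≠≥ n
map-ψVec∘φVec n = trans (sym (map-∘ (I≥≠≥ n)))
  (map-id-local (All.tabulate λ {e} e∈ → ψVec∘φVec e (proj₂ (to ∈-I≥≠≥⇔ e∈))))

φVec-↭ : ∀ n → map φVec (I≥≠≥ n) ↭ I>-≥ n
φVec-↭ n =
  ∼bag⇒↭ (unique∧set⇒bag image-unique (Unique.filter⁺ _ (invSeqs-unique n)) (mk⇔ image⊆ ⊆image))
  where
  image-unique : Unique (map φVec (I≥≠≥ n))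
  image-unique = Unique.map⁻ (subst Unique (sym (map-ψVec∘φVec n)) (Unique.filter⁺ _ (invSeqs-unique n)))
  image⊆ : ∀ {z} → z ∈ map φVec (I≥≠≥ n) → z ∈ I>-≥ n
  image⊆ z∈ with ∈-map⁻ φVec z∈
  ... | e , e∈ , refl = φVec-∈ e∈
  ⊆image : ∀ {z} → z ∈ I>-≥ n → z ∈ map φVec (I≥≠≥ n)
  ⊆image {z} z∈ =
    subst (_∈ map φVec (I≥≠≥ n)) (φVec∘ψVec z (proj₂ (to ∈-I>-≥⇔ z∈))) (∈-map⁺ φVec (ψVec-∈ z∈))

module _ {c ℓ : Level} (R : CommutativeSemiring c ℓ) where
  open CommutativeSemiring R using (_≈_; _*_; 1#; setoid; isEquivalence; +-isCommutativeMonoid)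

  weight-φVec : ∀ {n} s t u (e : Vec ℕ n) → Avoids Pat≥≠≥ (at e) n →
                weight R s t u (φVec e) ≡ weight R s t u e
  weight-φVec {n} s t u e av = cong₂ _*_ (cong₂ _*_ sROW-φVec tASC-φVec) (cong (powR R u) (lastE-φVec e))
    where
    sROW-φVec : sROW R s (φVec e) ≡ sROW R s e
    sROW-φVec = cong (prodR R) (map-cong (λ v → cong (λ b → if not (v ≡ᵇ 0) ∧ b then s v else 1#)
                                                    (valueTest-φVec e v)) (upTo n))
    tASC-φVec : tASC R t (φVec e) ≡ tASC R t e
    tASC-φVec = cong (prodR R) (concatMap-cong (λ p → concatMap-cong (λ q →
                  cong (λ b → if b then t (suc (toℕ p)) ∷ [] else []) (ascentTest-φVec e av p q)) (idx n)) (idx n))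

  map-weight-φVec : ∀ n s t u → map (weight R s t u) (I≥≠≥ n) ≡ map (weight R s t u ∘ φVec) (I≥≠≥ n)
  map-weight-φVec n s t u = map-cong-local (All.tabulate weight≡)
    where
    weight≡ : ∀ {e} → e ∈ I≥≠≥ n → weight R s t u e ≡ weight R s t u (φVec e)
    weight≡ {e} e∈ = sym (weight-φVec s t u e (proj₂ (to ∈-I≥≠≥⇔ e∈)))

  sumR-↭ : ∀ {xs ys} → xs ↭ ys → sumR R xs ≈ sumR R ys
  sumR-↭ xs↭ys = foldr-commMonoid setoid +-isCommutativeMonoid (↭⇒↭ₛ′ isEquivalence xs↭ys)

theorem3p6 : {c ℓ : Level} (n : ℕ) → 1 ≤ n → (R : CommutativeSemiring c ℓ) →
    (s t : ℕ → CommutativeSemiring.Carrier R) → (u : CommutativeSemiring.Carrier R) →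
    CommutativeSemiring._≈_ R (genSum R s t u (I≥≠≥ n)) (genSum R s t u (I>-≥ n))
theorem3p6 n _ R s t u = begin
  sumR R (map w (I≥≠≥ n))             ≡⟨ cong (sumR R) (map-weight-φVec R n s t u) ⟩
  sumR R (map (w ∘ φVec) (I≥≠≥ n))    ≡⟨ cong (sumR R) (map-∘ (I≥≠≥ n)) ⟩
  sumR R (map w (map φVec (I≥≠≥ n)))  ≈⟨ sumR-↭ R (map⁺ w (φVec-↭ n)) ⟩
  sumR R (map w (I>-≥ n))             ∎
  where
  open SetoidReasoning (CommutativeSemiring.setoid R)
  w = weight R s t u
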